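{- Let $G$ be a connected graph with vertex set $\{1,\dots,n\}$, $n\ge 2$, let $\Phi=(F_1,\dots,F_n)$ be an $n$-tuple of pairwise disjoint graphs with $|V(F_i)|\ge 3$ for all $i$, and let $G[\Phi]$ be the generalized lexicographic product. Then (i) $\gamma(G[\Phi])\equiv\gamma_r(G[\Phi])\equiv\gamma^{oc}(G[\Phi])$, and (ii) $\gamma_t(G[\Phi])\equiv\gamma_{tr}(G[\Phi])\equiv\gamma_t^{oc}(G[\Phi])$.
   Context: All graphs are finite, simple and undirected. The generalized lexicographic product $G[\Phi]$ is the graph with vertex set $\bigcup_{i=1}^n V(F_i)$ in which each $F_i$ is an induced subgraph, and for $x\in V(F_i)$, $y\in V(F_j)$ with $i\neq j$, $xy$ is an edge iff $ij\in E(G)$. For a graph $H$ and $S\subseteq V(H)$: $S$ is dominating if every vertex outside $S$ has a neighbor in $S$; total dominating if every vertex of $H$ has a neighbor in $S$; a dominating set $S$ is restrained if every vertex outside $S$ has a neighbor outside $S$, and outer-connected if the subgraph induced by $V(H)\setminus S$ is connected. $\gamma,\gamma_t,\gamma_r,\gamma_{tr},\gamma^{oc},\gamma_t^{oc}$ denote the minimum cardinalities of, respectively, dominating, total dominating, restrained dominating, total restrained dominating (total and restrained), outer-connected dominating, and total outer-connected dominating (total and outer-connected) sets; a $\nu$-set is a set of the type corresponding to $\nu$ of cardinality $\nu(H)$. For two such parameters $\mu,\nu$, we write $\mu(H)\equiv\nu(H)$ (strongly equal) if the set of all $\mu$-sets of $H$ coincides with the set of all $\nu$-sets of $H$. -}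

module Defs where

open import Data.Nat using (ℕ; _≤_)
open import Data.Fin using (Fin)
open import Data.Product using (Σ; _×_; _,_)
open import Data.Unit using (⊤)
open import Data.List using (List; length)
open import Data.List.Membership.Propositional using (_∈_; _∉_)
open import Data.List.Relation.Unary.Unique.Propositional using (Unique)
open import Relation.Nullary using (¬_)
open import Function.Bundles using (_⇔_)

record Graph (V : Set) : Set₁ where
  field
    Adj    : V → V → Set
    sym    : ∀ {u v} → Adj u v → Adj v u
    irrefl : ∀ {u} → ¬ Adj u u
open Graph public

record FinEnum (V : Set) : Set where
  field
    enum     : List V
    complete : ∀ v → v ∈ enum
    unique   : Unique enum
open FinEnum public

order : {V : Set} → FinEnum V → ℕ
order f = length (enum f)

VSet : Set → Set
VSet V = Σ (List V) Unique

elems : {V : Set} → VSet V → List V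
elems (xs , _) = xs

card : {V : Set} → VSet V → ℕ
card S = length (elems S)

_∈S_ : {V : Set} → V → VSet V → Set
v ∈S S = v ∈ elems S

_∉S_ : {V : Set} → V → VSet V → Set
v ∉S S = v ∉ elems S

-- Walks in H all of whose vertices satisfy P (walks in the subgraph induced by P).
data ConnIn {V : Set} (H : Graph V) (P : V → Set) : V → V → Set where
  here : ∀ {u} → P u → ConnIn H P u u
  step : ∀ {u w v} → P u → Adj H u w → ConnIn H P w v → ConnIn H P u v

Connected : {V : Set} → Graph V → Set
Connected H = ∀ u v → ConnIn H (λ _ → ⊤) u v

Dominating : {V : Set} → Graph V → VSet V → Set
Dominating {V} H S = ∀ v → v ∉S S → Σ V λ u → u ∈S S × Adj H v u

TotalDominating : {V : Set} → Graph V → VSet V → Set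
TotalDominating {V} H S = ∀ v → Σ V λ u → u ∈S S × Adj H v u

Restrained : {V : Set} → Graph V → VSet V → Set
Restrained {V} H S = ∀ v → v ∉S S → Σ V λ u → u ∉S S × Adj H v u

-- V \ S induces a connected subgraph (vacuous when V \ S is empty)
OuterConnected : {V : Set} → Graph V → VSet V → Set
OuterConnected H S = ∀ u v → u ∉S S → v ∉S S → ConnIn H (λ x → x ∉S S) u v

RestrainedDominating : {V : Set} → Graph V → VSet V → Set
RestrainedDominating H S = Dominating H S × Restrained H S

TotalRestrainedDominating : {V : Set} → Graph V → VSet V → Set
TotalRestrainedDominating H S = TotalDominating H S × Restrained H S

OuterConnectedDominating : {V : Set} → Graph V → VSet V → Set
OuterConnectedDominating H S = Dominating H S × OuterConnected H S

TotalOuterConnectedDominating : {V : Set} → Graph V → VSet V → Set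
TotalOuterConnectedDominating H S = TotalDominating H S × OuterConnected H S

IsMinSet : {V : Set} → (VSet V → Set) → VSet V → Set
IsMinSet ν S = ν S × (∀ T → ν T → card S ≤ card T)

StronglyEqual : {V : Set} → (VSet V → Set) → (VSet V → Set) → Set
StronglyEqual μ ν = ∀ S → IsMinSet μ S ⇔ IsMinSet ν S

-- Generalized lexicographic product G[Φ] with G on {0,…,n-1} and Φ = (F i)_i.
-- Vertex set: disjoint union Σ i, Vs i (so the F i are pairwise disjoint).
LexV : {n : ℕ} → (Fin n → Set) → Set
LexV {n} Vs = Σ (Fin n) Vs

data LexAdj {n : ℕ} {Vs : Fin n → Set} (G : Graph (Fin n)) (F : (i : Fin n) → Graph (Vs i))
  : LexV Vs → LexV Vs → Set where
  inner : ∀ {i x y} → Adj (F i) x y → LexAdj G F (i , x) (i , y)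
  outer : ∀ {i j x y} → Adj G i j → LexAdj G F (i , x) (j , y)

lexSym : {n : ℕ} {Vs : Fin n → Set} (G : Graph (Fin n)) (F : (i : Fin n) → Graph (Vs i))
  → ∀ {u v} → LexAdj G F u v → LexAdj G F v u
lexSym G F (inner a) = inner (sym (F _) a)
lexSym G F (outer a) = outer (sym G a)

lexIrrefl : {n : ℕ} {Vs : Fin n → Set} (G : Graph (Fin n)) (F : (i : Fin n) → Graph (Vs i))
  → ∀ {u} → ¬ LexAdj G F u u
lexIrrefl G F (inner a) = irrefl (F _) a
lexIrrefl G F (outer a) = irrefl G a

LexProduct : {n : ℕ} {Vs : Fin n → Set} (G : Graph (Fin n)) (F : (i : Fin n) → Graph (Vs i))
  → Graph (LexV Vs)
LexProduct G F = record { Adj = LexAdj G F ; sym = lexSym G F ; irrefl = lexIrrefl G F }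

module Submission where

open import Defs
open import Data.Nat using (ℕ; suc; _≤_; _<_; s≤s)
open import Data.Nat.Properties using (≤-refl; ≤-trans; <⇒≤; <⇒≱; n≤1+n)
open import Data.Nat.Induction using (<-wellFounded)
open import Induction.WellFounded using (Acc; acc)
open import Data.Fin using (Fin) renaming (zero to fzero; suc to fsuc)
open import Data.Fin.Properties using () renaming (_≟_ to _≟F_; any? to anyFin?)
open import Data.Product using (Σ; _×_; _,_; proj₁; proj₂)
open import Data.Product.Properties using (≡-dec)
open import Data.Sum using (_⊎_; inj₁; inj₂)
open import Data.Unit using (⊤)
open import Data.Empty using (⊥-elim)
open import Data.List using (List; _∷_; length; filter)
open import Data.List.Properties using (filter-notAll)
open import Data.List.Relation.Unary.Any using (here; there; satisfied) renaming (map to mapAny)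
open import Data.List.Relation.Unary.All using (All; _∷_; all?; tabulate) renaming (lookup to lookupAll)
open import Data.List.Relation.Unary.All.Properties using (¬All⇒Any¬; ¬Any⇒All¬)
open import Data.List.Membership.Propositional using (_∈_)
open import Data.List.Membership.Propositional.Properties using (∈-filter⁺)
open import Data.List.Membership.DecPropositional as DecMembership using ()
open import Data.List.Relation.Unary.Unique.Propositional using (Unique; _∷_)
open import Data.List.Relation.Unary.Unique.Propositional.Properties using (filter⁺)
open import Relation.Nullary using (Dec; yes; no; ¬?)
open import Relation.Nullary.Decidable using (map′)
open import Relation.Binary.Definitions using (DecidableEquality)
open import Relation.Binary.PropositionalEquality using (_≡_; _≢_; refl) renaming (sym to ≡-sym)
open import Function.Bundles using (mk⇔)
import Function.Properties.Equivalence as ⇔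

-- Call S fiber-sparse if every fiber {i} × V(F i) has a vertex outside S. A
-- fiber-sparse set is restrained and outer-connected: every fiber has a
-- neighbouring fiber in the connected graph G, and all vertices of a fiber are
-- adjacent to all vertices of the neighbouring fibers. Conversely, if a
-- (total) dominating set S contains a whole fiber i (of at least three
-- vertices), trading two of them for one vertex in a neighbouring fiber gives
-- a smaller (total) dominating set. Hence minimum dominating and total
-- dominating sets are fiber-sparse, every (total) dominating set can be made
-- fiber-sparse without growing, and the strong equalities follow.

≟-fromUnique : {A : Set} {xs : List A} → Unique xs → ∀ {x y} → x ∈ xs → y ∈ xs → Dec (x ≡ y)
≟-fromUnique _               (here refl) (here refl) = yes refl
≟-fromUnique (x≢xs ∷ _)      (here refl) (there y∈) = no λ x≡y → lookupAll x≢xs y∈ x≡y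
≟-fromUnique (y≢xs ∷ _)      (there x∈) (here refl) = no λ x≡y → lookupAll y≢xs x∈ (≡-sym x≡y)
≟-fromUnique (_ ∷ unique-xs) (there x∈) (there y∈) = ≟-fromUnique unique-xs x∈ y∈

≟-fromFinEnum : {A : Set} → FinEnum A → DecidableEquality A
≟-fromFinEnum e x y = ≟-fromUnique (unique e) (complete e x) (complete e y)

distinct₃ : {A : Set} (xs : List A) → 3 ≤ length xs → Unique xs →
  Σ A λ a → Σ A λ b → Σ A λ c → a ≢ b × a ≢ c × b ≢ c
distinct₃ (a ∷ b ∷ c ∷ _) (s≤s (s≤s (s≤s _))) ((a≢b ∷ a≢c ∷ _) ∷ (b≢c ∷ _) ∷ _) =
  a , b , c , a≢b , a≢c , b≢c

another : ∀ {n} → 2 ≤ n → (i : Fin n) → Σ (Fin n) λ j → i ≢ j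
another (s≤s (s≤s _)) fzero    = fsuc fzero , λ ()
another (s≤s (s≤s _)) (fsuc i) = fzero , λ ()

neighbour-from-walk : {V : Set} (H : Graph V) {P : V → Set} {u v : V} →
  u ≢ v → ConnIn H P u v → Σ V (Adj H u)
neighbour-from-walk H u≢u (here _)             = ⊥-elim (u≢u refl)
neighbour-from-walk H _   (step {w = w} _ a _) = w , a

Shrinkable : {V : Set} (P Good : VSet V → Set) → Set
Shrinkable {V} P Good = ∀ S → P S → Good S ⊎ Σ (VSet V) λ S' → P S' × card S' < card S

module Shrinking {V : Set} (P Good : VSet V → Set) (shrink : Shrinkable P Good) where

  minimum⇒good : ∀ S → IsMinSet P S → Good S
  minimum⇒good S (pS , minimal) with shrink S pS
  ... | inj₁ good              = good
  ... | inj₂ (S' , pS' , S'<S) = ⊥-elim (<⇒≱ S'<S (minimal S' pS'))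

  good-below : ∀ S → Acc _<_ (card S) → P S → Σ (VSet V) λ T → P T × Good T × card T ≤ card S
  good-below S (acc smaller) pS with shrink S pS
  ... | inj₁ good              = S , pS , good , ≤-refl
  ... | inj₂ (S' , pS' , S'<S) with good-below S' (smaller S'<S) pS'
  ...   | T , pT , goodT , T≤S' = T , pT , goodT , ≤-trans T≤S' (<⇒≤ S'<S)

  stronglyEqual-× : (R : VSet V → Set) → (∀ S → Good S → R S) →
    StronglyEqual P (λ S → P S × R S)
  stronglyEqual-× R good⇒R S = mk⇔ to from
    where
    to : IsMinSet P S → IsMinSet (λ T → P T × R T) S
    to (pS , minimal) = (pS , good⇒R S (minimum⇒good S (pS , minimal))) , λ T pT → minimal T (proj₁ pT)
    from : IsMinSet (λ T → P T × R T) S → IsMinSet P S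
    from ((pS , _) , minimal) = pS , below
      where
      below : ∀ T → P T → card S ≤ card T
      below T pT with good-below T (<-wellFounded (card T)) pT
      ... | T' , pT' , goodT' , T'≤T = ≤-trans (minimal T' (pT' , good⇒R T' goodT')) T'≤T

module VertexSets {V : Set} (_≟_ : DecidableEquality V) where
  open DecMembership _≟_ using (_∈?_)

  remove : V → VSet V → VSet V
  remove x (xs , u) = filter (λ v → ¬? (v ≟ x)) xs , filter⁺ (λ v → ¬? (v ≟ x)) u

  ∈-remove⁺ : ∀ {x v} S → v ∈S S → v ≢ x → v ∈S remove x S
  ∈-remove⁺ {x} (xs , _) = ∈-filter⁺ (λ v → ¬? (v ≟ x))

  card-remove : ∀ {x} S → x ∈S S → card (remove x S) < card S
  card-remove {x} (xs , _) x∈ = filter-notAll (λ v → ¬? (v ≟ x)) xs (mapAny (λ { refl ¬x≢x → ¬x≢x refl }) x∈)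

  insert : V → VSet V → VSet V
  insert x (xs , u) with x ∈? xs
  ... | yes _  = xs , u
  ... | no x∉ = x ∷ xs , ¬Any⇒All¬ xs x∉ ∷ u

  ∈-insert-self : ∀ x S → x ∈S insert x S
  ∈-insert-self x (xs , _) with x ∈? xs
  ... | yes x∈ = x∈
  ... | no _   = here refl

  ∈-insert⁺ : ∀ x {v} S → v ∈S S → v ∈S insert x S
  ∈-insert⁺ x (xs , _) v∈ with x ∈? xs
  ... | yes _ = v∈
  ... | no _  = there v∈

  card-insert : ∀ x S → card (insert x S) ≤ suc (card S)
  card-insert x (xs , _) with x ∈? xs
  ... | yes _ = n≤1+n _
  ... | no _  = ≤-refl

module _ {n : ℕ} (G : Graph (Fin n)) {Vs : Fin n → Set} (F : (i : Fin n) → Graph (Vs i))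
  (fin : (i : Fin n) → FinEnum (Vs i)) where

  private
    V = LexV Vs
    H = LexProduct G F

  _≟V_ : DecidableEquality V
  _≟V_ = ≡-dec _≟F_ (λ {i} → ≟-fromFinEnum (fin i))

  open VertexSets _≟V_
  open DecMembership _≟V_ using (_∈?_)

  FiberFull : VSet V → Fin n → Set
  FiberFull S i = ∀ a → (i , a) ∈S S

  FiberSparse : VSet V → Set
  FiberSparse S = ∀ i → Σ (Vs i) λ a → (i , a) ∉S S

  all⇒fiberFull : ∀ S i → All (λ a → (i , a) ∈S S) (enum (fin i)) → FiberFull S i
  all⇒fiberFull S i all a = lookupAll all (complete (fin i) a)

  fiberFull? : ∀ S i → Dec (FiberFull S i)
  fiberFull? S i = map′ (all⇒fiberFull S i) (λ full → tabulate λ {a} _ → full a)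
    (all? (λ a → (i , a) ∈? elems S) (enum (fin i)))

  fiberFull⊎fiberSparse : ∀ S → Σ (Fin n) (FiberFull S) ⊎ FiberSparse S
  fiberFull⊎fiberSparse S with anyFin? (fiberFull? S)
  ... | yes full = inj₁ full
  ... | no ¬full = inj₂ λ i → satisfied (¬All⇒Any¬ (λ a → (i , a) ∈? elems S) (enum (fin i))
                                 λ all → ¬full (i , all⇒fiberFull S i all))

  module _ (neighbour : ∀ i → Σ (Fin n) (Adj G i)) where

    sparse⇒restrained : ∀ S → FiberSparse S → Restrained H S
    sparse⇒restrained S sparse (k , _) _ =
      let (w , k~w) = neighbour k in (w , proj₁ (sparse w)) , proj₂ (sparse w) , outer k~w

    lift-walk : ∀ S → FiberSparse S → ∀ {k l} → ConnIn G (λ _ → ⊤) k l →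
      ∀ {x z} → (k , x) ∉S S → (l , z) ∉S S → ConnIn H (_∉S S) (k , x) (l , z)
    lift-walk S sparse {k} (here _) x∉ z∉ =
      let (w , k~w) = neighbour k
      in step x∉ (outer k~w) (step (proj₂ (sparse w)) (outer (Graph.sym G k~w)) (here z∉))
    lift-walk S sparse (step {w = w} _ k~w walk) x∉ z∉ =
      step x∉ (outer k~w) (lift-walk S sparse walk (proj₂ (sparse w)) z∉)

    sparse⇒outerConnected : Connected G → ∀ S → FiberSparse S → OuterConnected H S
    sparse⇒outerConnected conn S sparse (k , _) (l , _) = lift-walk S sparse (conn k l)

  fibers-adjacent : ∀ {k j z x} → k ≢ j → Adj H (k , z) (j , x) → Adj G k j
  fibers-adjacent k≢k (inner _) = ⊥-elim (k≢k refl)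
  fibers-adjacent _   (outer k~j) = k~j

  module Collapse (S : VSet V) (i : Fin n) (full : FiberFull S i)
    {a b c : Vs i} (a≢b : a ≢ b) (a≢c : a ≢ c) (b≢c : b ≢ c)
    {w : Fin n} (i~w : Adj G i w) (y : Vs w) where

    S₁ S₂ collapsed : VSet V
    S₁ = remove (i , b) S
    S₂ = remove (i , c) S₁
    collapsed = insert (w , y) S₂

    card-collapsed : card collapsed < card S
    card-collapsed =
      ≤-trans (s≤s (≤-trans (card-insert (w , y) S₂) (card-remove S₁ c∈S₁))) (card-remove S (full b))
      where
      c∈S₁ : (i , c) ∈S S₁
      c∈S₁ = ∈-remove⁺ S (full c) λ { refl → b≢c refl }

    y∈collapsed : (w , y) ∈S collapsed
    y∈collapsed = ∈-insert-self (w , y) S₂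

    ∈-collapsed : ∀ {v} → v ∈S S → proj₁ v ≢ i → v ∈S collapsed
    ∈-collapsed v∈ v∉i =
      ∈-insert⁺ (w , y) S₂ (∈-remove⁺ S₁ (∈-remove⁺ S v∈ λ { refl → v∉i refl }) λ { refl → v∉i refl })

    a∈collapsed : (i , a) ∈S collapsed
    a∈collapsed =
      ∈-insert⁺ (w , y) S₂ (∈-remove⁺ S₁ (∈-remove⁺ S (full a) λ { refl → a≢b refl }) λ { refl → a≢c refl })

    reroute : ∀ {v u} → proj₁ v ≢ i → u ∈S S → Adj H v u → Σ V λ u' → u' ∈S collapsed × Adj H v u'
    reroute {u = j , x} k≢i u∈ v~u with j ≟F i
    ... | no j≢i   = (j , x) , ∈-collapsed u∈ j≢i , v~u
    ... | yes refl = (i , a) , a∈collapsed , outer (fibers-adjacent k≢i v~u)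

    dominating : Dominating H S → Dominating H collapsed
    dominating dom (k , z) v∉ with k ≟F i
    ... | yes refl = (w , y) , y∈collapsed , outer i~w
    ... | no k≢i   = let (u , u∈ , v~u) = dom (k , z) (λ v∈ → v∉ (∈-collapsed v∈ k≢i)) in reroute k≢i u∈ v~u

    totalDominating : TotalDominating H S → TotalDominating H collapsed
    totalDominating dom (k , z) with k ≟F i
    ... | yes refl = (w , y) , y∈collapsed , outer i~w
    ... | no k≢i   = let (u , u∈ , v~u) = dom (k , z) in reroute k≢i u∈ v~u

  module _ (neighbour : ∀ i → Σ (Fin n) (Adj G i)) (big : ∀ i → 3 ≤ order (fin i)) where

    collapse-full-fiber : ∀ S i → FiberFull S i → Σ (VSet V) λ S' → card S' < card S
      × (Dominating H S → Dominating H S') × (TotalDominating H S → TotalDominating H S')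
    collapse-full-fiber S i full
      with distinct₃ (enum (fin i)) (big i) (unique (fin i)) | neighbour i
    ... | a , b , c , a≢b , a≢c , b≢c | w , i~w =
      collapsed , card-collapsed , dominating , totalDominating
      where open Collapse S i full a≢b a≢c b≢c i~w (proj₁ (distinct₃ (enum (fin w)) (big w) (unique (fin w))))

    dominating-shrinkable : Shrinkable (Dominating H) FiberSparse
    dominating-shrinkable S dom with fiberFull⊎fiberSparse S
    ... | inj₂ sparse   = inj₁ sparse
    ... | inj₁ (i , full) =
      let (S' , S'<S , preserve , _) = collapse-full-fiber S i full in inj₂ (S' , preserve dom , S'<S)

    totalDominating-shrinkable : Shrinkable (TotalDominating H) FiberSparse
    totalDominating-shrinkable S dom with fiberFull⊎fiberSparse S
    ... | inj₂ sparse   = inj₁ sparse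
    ... | inj₁ (i , full) =
      let (S' , S'<S , _ , preserve) = collapse-full-fiber S i full in inj₂ (S' , preserve dom , S'<S)

theorem2p8 : (n : ℕ) → 2 ≤ n → (G : Graph (Fin n)) → Connected G →
    (Vs : Fin n → Set) → (F : (i : Fin n) → Graph (Vs i)) →
    (fin : (i : Fin n) → FinEnum (Vs i)) → ((i : Fin n) → 3 ≤ order (fin i)) →
    (StronglyEqual (Dominating (LexProduct G F)) (RestrainedDominating (LexProduct G F))
      × StronglyEqual (RestrainedDominating (LexProduct G F)) (OuterConnectedDominating (LexProduct G F)))
    × (StronglyEqual (TotalDominating (LexProduct G F)) (TotalRestrainedDominating (LexProduct G F))
      × StronglyEqual (TotalRestrainedDominating (LexProduct G F)) (TotalOuterConnectedDominating (LexProduct G F)))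
theorem2p8 n 2≤n G conn Vs F fin big =
  (D-restrained , λ S → ⇔.trans (⇔.sym (D-restrained S)) (D-outerConnected S))
  , (T-restrained , λ S → ⇔.trans (⇔.sym (T-restrained S)) (T-outerConnected S))
  where
  H : Graph (LexV Vs)
  H = LexProduct G F
  neighbour : ∀ i → Σ (Fin n) (Adj G i)
  neighbour i = let (j , i≢j) = another 2≤n i in neighbour-from-walk G i≢j (conn i j)
  restrained : ∀ S → FiberSparse G F fin S → Restrained H S
  restrained = sparse⇒restrained G F fin neighbour
  outerConnected : ∀ S → FiberSparse G F fin S → OuterConnected H S
  outerConnected = sparse⇒outerConnected G F fin neighbour conn
  module D = Shrinking (Dominating H) (FiberSparse G F fin) (dominating-shrinkable G F fin neighbour big)
  module T = Shrinking (TotalDominating H) (FiberSparse G F fin) (totalDominating-shrinkable G F fin neighbour big)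
  D-restrained : StronglyEqual (Dominating H) (RestrainedDominating H)
  D-restrained = D.stronglyEqual-× (Restrained H) restrained
  D-outerConnected : StronglyEqual (Dominating H) (OuterConnectedDominating H)
  D-outerConnected = D.stronglyEqual-× (OuterConnected H) outerConnected
  T-restrained : StronglyEqual (TotalDominating H) (TotalRestrainedDominating H)
  T-restrained = T.stronglyEqual-× (Restrained H) restrained
  T-outerConnected : StronglyEqual (TotalDominating H) (TotalOuterConnectedDominating H)
  T-outerConnected = T.stronglyEqual-× (OuterConnected H) outerConnected
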